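{- Let $x$ be a word over $\Gamma$. Then there exist $M,N\in\mathbf N$ with $M\ge m(x)$, $N\ge n(x)$ such that $u_x-u_{[x]_{m,n}}\in J$ for all $m\ge M$ and $n\ge N$.
   Context: $\Gamma=\{1,2,\dots\}\cup\{\bar1,\bar2,\dots\}$; $\mathcal U$ is the free associative $\mathbf C$-algebra on $u_a$, $a\in\Gamma$, with $d_i=u_{\bar i}$ and $u_x=u_{x_1}\cdots u_{x_\ell}$ for a word $x=x_1\cdots x_\ell$. $J$ is the two-sided ideal of $\mathcal U$ generated by $u_iu_j-u_ju_i$ ($|i-j|\ge2$), $d_id_j-d_jd_i$ ($|i-j|\ge2$), $d_iu_j-u_jd_i$ ($i\ne j$), $d_1u_1-1$, and $d_{i+1}u_{i+1}-u_id_i$ ($i\ge1$). The weight has $w_i(x)$ = (number of $i$'s in $x$) $-$ (number of $\bar i$'s); $\alpha_i(x)=\max\{w_{i+1}(\tilde x)-w_i(\tilde x)\}$ over all suffixes $\tilde x=x_j\cdots x_\ell$ ($1\le j\le\ell+1$, including the empty suffix). Define $m(x)=\max_{i\ge1}\{ -(\alpha_i(x)+w_i(x))\}\ge0$, $n(x)=\max\{t: t\text{ or }\bar t\text{ occurs in }x\}$, and for $m\ge m(x)$, $n\ge n(x)$, with $\beta^m_i(x)=\alpha_i(x)+w_i(x)+m$, \[ [x]_{m,n}=(\bar1^{m}\cdots\bar n^{m})\,(n^{\beta^m_n(x)}\,\bar n^{\alpha_n(x)}\cdots 1^{\beta^m_1(x)}\,\bar1^{\alpha_1(x)}), \] where $a^k$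 denotes the letter $a$ repeated $k$ times and the second factor lists, for $k=n,n-1,\dots,1$ in that order, $k^{\beta^m_k(x)}\bar k^{\alpha_k(x)}$. -}

module Defs where

open import Level using (Level; _⊔_)
open import Data.Nat as ℕ using (ℕ; zero; suc)
import Data.Nat.Properties as ℕP
open import Data.Integer as ℤ using (ℤ; +_; ∣_∣)
open import Data.List using (List; []; _∷_; _++_; map; foldr; concatMap; replicate; downFrom; applyUpTo)
import Data.Sum
open import Data.Product using (Σ; _×_; _,_; ∃)
open import Relation.Nullary using (Dec; yes; no; ¬_)
open import Relation.Binary.PropositionalEquality using (_≡_; refl; cong)
open import Relation.Nullary.Decidable using (map′)
open import Data.List.Relation.Unary.All using (All)
open import Algebra.Bundles using (CommutativeRing)

-- Alphabet Γ = {1,2,…} ∪ {1̄,2̄,…}.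
-- `u i` is the letter i, `d i` is the letter ī.  Only indices i ≥ 1 are
-- letters of Γ; index 0 is excluded via the predicate `ValidWord`.

data Letter : Set where
  u : ℕ → Letter
  d : ℕ → Letter

Word : Set
Word = List Letter

ValidLetter : Letter → Set
ValidLetter (u i) = 1 ℕ.≤ i
ValidLetter (d i) = 1 ℕ.≤ i

ValidWord : Word → Set
ValidWord = All ValidLetter

_≟L_ : (a b : Letter) → Dec (a ≡ b)
u i ≟L u j = map′ (cong u) (λ { refl → refl }) (i ℕ.≟ j)
u i ≟L d j = no (λ ())
d i ≟L u j = no (λ ())
d i ≟L d j = map′ (cong d) (λ { refl → refl }) (i ℕ.≟ j)

_≟W_ : (x y : Word) → Dec (x ≡ y)
[] ≟W [] = yes refl
[] ≟W (_ ∷ _) = no (λ ())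
(_ ∷ _) ≟W [] = no (λ ())
(a ∷ x) ≟W (b ∷ y) with a ≟L b | x ≟W y
... | yes refl | yes refl = yes refl
... | no ¬p | _ = no (λ { refl → ¬p refl })
... | yes _ | no ¬q = no (λ { refl → ¬q refl })

w : ℕ → Word → ℤ
w i [] = + 0
w i (u j ∷ x) with i ℕ.≟ j
... | yes _ = ℤ.suc (w i x)
... | no _  = w i x
w i (d j ∷ x) with i ℕ.≟ j
... | yes _ = ℤ.pred (w i x)
... | no _  = w i x

α : ℕ → Word → ℤ
α i [] = + 0
α i (a ∷ x) = (w (suc i) (a ∷ x) ℤ.- w i (a ∷ x)) ℤ.⊔ α i x

idx : Letter → ℕ
idx (u i) = i
idx (d i) = i

nW : Word → ℕ
nW x = foldr (λ a r → idx a ℕ.⊔ r) 0 x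

-- m(x) = max_{i ≥ 1} −(α_i(x) + w_i(x)).  For i > n(x) one has
-- α_i(x) = w_i(x) = 0, so the maximum is attained on i ∈ {1,…,n(x)+1}
-- and this finite maximum (together with the value 0 attained at
-- i = n(x)+1) is what is computed here.
mW : Word → ℤ
mW x = foldr (λ i r → (ℤ.- (α i x ℤ.+ w i x)) ℤ.⊔ r) (+ 0)
             (applyUpTo suc (suc (nW x)))

β : ℕ → Word → ℕ → ℤ
β m x i = α i x ℤ.+ w i x ℤ.+ + m

-- [x]_{m,n} = (1̄^m ⋯ n̄^m)(n^{β_n} n̄^{α_n} ⋯ 1^{β_1} 1̄^{α_1}).
-- Exponents are integers that are ≥ 0 whenever m ≥ m(x); they are
-- converted to ℕ via ∣_∣.
bracket : Word → ℕ → ℕ → Word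
bracket x m n =
  concatMap (λ k → replicate m (d k)) (applyUpTo suc n)
  ++ concatMap (λ k → replicate (∣ β m x k ∣) (u k) ++ replicate (∣ α k x ∣) (d k))
               (map suc (downFrom n))

-- The free associative algebra 𝒰 over a commutative ring R, with
-- elements represented as formal sums ∑ c·u_w (lists of (coefficient,
-- word)); two formal sums denote the same element iff they have the
-- same coefficient at every word.

module FreeAlg {c ℓ : Level} (R : CommutativeRing c ℓ) where
  open CommutativeRing R

  Elt : Set c
  Elt = List (Carrier × Word)

  coeff : Elt → Word → Carrier
  coeff [] v = 0#
  coeff ((r , x) ∷ f) v with x ≟W v
  ... | yes _ = r + coeff f v
  ... | no _  = coeff f v

  _≋_ : Elt → Elt → Set ℓ
  f ≋ g = ∀ v → coeff f v ≈ coeff g v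

  mon : Word → Elt
  mon x = (1# , x) ∷ []

  _⊖_ : Elt → Elt → Elt
  f ⊖ g = f ++ map (λ { (r , x) → (- r , x) }) g

  sandwich : Carrier → Word → Elt → Word → Elt
  sandwich r a f b = map (λ { (s , x) → (r * s , a ++ x ++ b) }) f

  data Gen : Set where
    uu  : (i j : ℕ) → 1 ℕ.≤ i → 1 ℕ.≤ j → (2 ℕ.+ i ℕ.≤ j) Data.Sum.⊎ (2 ℕ.+ j ℕ.≤ i) → Gen
    dd  : (i j : ℕ) → 1 ℕ.≤ i → 1 ℕ.≤ j → (2 ℕ.+ i ℕ.≤ j) Data.Sum.⊎ (2 ℕ.+ j ℕ.≤ i) → Gen
    du  : (i j : ℕ) → 1 ℕ.≤ i → 1 ℕ.≤ j → ¬ (i ≡ j) → Gen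
    d1u1 : Gen
    dudu : (i : ℕ) → 1 ℕ.≤ i → Gen

  gen : Gen → Elt
  gen (uu i j _ _ _) = mon (u i ∷ u j ∷ []) ⊖ mon (u j ∷ u i ∷ [])
  gen (dd i j _ _ _) = mon (d i ∷ d j ∷ []) ⊖ mon (d j ∷ d i ∷ [])
  gen (du i j _ _ _) = mon (d i ∷ u j ∷ []) ⊖ mon (u j ∷ d i ∷ [])
  gen d1u1           = mon (d 1 ∷ u 1 ∷ []) ⊖ mon []
  gen (dudu i _)     = mon (d (suc i) ∷ u (suc i) ∷ []) ⊖ mon (u i ∷ d i ∷ [])

  combo : List (Carrier × Word × Gen × Word) → Elt
  combo [] = []
  combo ((r , a , g , b) ∷ t) = sandwich r a (gen g) b ++ combo t

  InJ : Elt → Set (c ⊔ ℓ)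
  InJ f = ∃ λ (L : List (Carrier × Word × Gen × Word)) → f ≋ combo L

-- Write U_k = u_k ⋯ u_1 and D_k = d_1 ⋯ d_k. Modulo J one has D_k U_k = 1, u_{k+1} = D_k U_{k+1},
-- d_{k+1} = D_{k+1} U_k, and U_k, D_k commute with U_i and D_i for every i < k. Hence prepending the
-- letters of a word one at a time to the empty product turns it into a normal form
-- U_1^{a_1} D_1^{c_1} ⋯ U_n^{a_n} D_n^{c_n}, and tracking the effect of each letter on (a_j , c_j) shows
-- c_j = α_j(x) and a_j = α_j(x) − (w_{j+1}(x) − w_j(x)). For [x]_{m,n} the exponents can instead be read
-- off block by block; once every β^m_i(x) is non-negative they coincide with those of x, so x and
-- [x]_{m,n} have the same normal form.

module Submission where

open import Defs
open import Level using (Level)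
open import Function.Base using (_∘_)
open import Data.Nat as ℕ using (ℕ; zero; suc; _≤_; _<_; s≤s; z≤n)
import Data.Nat.Properties as ℕP
open import Data.List using (List; []; _∷_; [_]; _++_; _∷ʳ_; map; reverse; replicate; concatMap; applyUpTo; downFrom; foldr; length)
open import Data.List.Properties using (++-assoc; ++-identityʳ; map-++; reverse-++; foldr-++; concatMap-++; applyUpTo-∷ʳ)
open import Data.List.Relation.Unary.All using (All; []; _∷_)
open import Data.List.Relation.Unary.All.Properties using (++⁺; concat⁺; map⁺; applyUpTo⁺₁; replicate⁺)
open import Data.Product using (Σ; _×_; _,_; proj₁; proj₂)
open import Data.Sum using (_⊎_; inj₁; inj₂; swap)
open import Relation.Nullary using (Dec; yes; no)
open import Relation.Binary.Definitions using (tri<; tri≈; tri>)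
open import Data.Empty using (⊥-elim)
open import Relation.Binary.PropositionalEquality as ≡ using (_≡_; _≢_; refl; cong; cong₂; subst₂)
open import Relation.Binary.Construct.Closure.ReflexiveTransitive using (ε; _◅_)
open import Relation.Binary.Construct.Closure.Symmetric using (SymClosure; fwd; bwd)
open import Relation.Binary.Construct.Closure.Equivalence as EqClosure using (EqClosure)
open import Algebra.Bundles using (CommutativeRing)
open import Data.Integer using (ℤ; +_; -[1+_]; 1ℤ; -1ℤ; ∣_∣; -≤+) renaming (_≤_ to _≤ℤ_)
open import Data.Integer.Base using () renaming (+≤+ to +≤+ᶻ)
import Data.Integer.Properties as ℤP
open import Data.Integer.Tactic.RingSolver using (solve-∀)
import Relation.Binary.Reasoning.Setoid as SetoidReasoning

-- `Relator a b` says that a − b is one of the generators of J.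
data Relator : Word → Word → Set where
  uu-comm  : ∀ i j → 1 ≤ i → 1 ≤ j → (2 ℕ.+ i ≤ j) ⊎ (2 ℕ.+ j ≤ i) →
             Relator (u i ∷ u j ∷ []) (u j ∷ u i ∷ [])
  dd-comm  : ∀ i j → 1 ≤ i → 1 ≤ j → (2 ℕ.+ i ≤ j) ⊎ (2 ℕ.+ j ≤ i) →
             Relator (d i ∷ d j ∷ []) (d j ∷ d i ∷ [])
  du-comm  : ∀ i j → 1 ≤ i → 1 ≤ j → i ≢ j → Relator (d i ∷ u j ∷ []) (u j ∷ d i ∷ [])
  d₁u₁     : Relator (d 1 ∷ u 1 ∷ []) []
  du-shift : ∀ i → 1 ≤ i → Relator (d (suc i) ∷ u (suc i) ∷ []) (u i ∷ d i ∷ [])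

data Step : Word → Word → Set where
  step : ∀ p q {a b} → Relator a b → Step (p ++ a ++ q) (p ++ b ++ q)

infix 4 _≈ᴶ_
_≈ᴶ_ : Word → Word → Set
_≈ᴶ_ = EqClosure Step

module ≈ᴶ-Reasoning = SetoidReasoning (EqClosure.setoid Step)

≈ᴶ-sym : ∀ {x y} → x ≈ᴶ y → y ≈ᴶ x
≈ᴶ-sym = EqClosure.symmetric Step

≡⇒≈ᴶ : ∀ {x y} → x ≡ y → x ≈ᴶ y
≡⇒≈ᴶ refl = ε

relator⇒≈ᴶ : ∀ {a b} → Relator a b → a ≈ᴶ b
relator⇒≈ᴶ {a} {b} g = subst₂ _≈ᴶ_ (++-identityʳ a) (++-identityʳ b) (fwd (step [] [] g) ◅ ε)

≈ᴶ-prefix : ∀ r {x y} → x ≈ᴶ y → r ++ x ≈ᴶ r ++ y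
≈ᴶ-prefix r = EqClosure.gmap (r ++_) prefix-step
  where
  prefix-step : ∀ {x y} → Step x y → Step (r ++ x) (r ++ y)
  prefix-step (step p q {a} {b} g) =
    subst₂ Step (++-assoc r p (a ++ q)) (++-assoc r p (b ++ q)) (step (r ++ p) q g)

≈ᴶ-suffix : ∀ s {x y} → x ≈ᴶ y → x ++ s ≈ᴶ y ++ s
≈ᴶ-suffix s = EqClosure.gmap (_++ s) suffix-step
  where
  reassoc : ∀ p a q → p ++ a ++ q ++ s ≡ (p ++ a ++ q) ++ s
  reassoc p a q = ≡.sym (≡.trans (++-assoc p (a ++ q) s) (cong (p ++_) (++-assoc a q s)))

  suffix-step : ∀ {x y} → Step x y → Step (x ++ s) (y ++ s)
  suffix-step (step p q {a} {b} g) = subst₂ Step (reassoc p a q) (reassoc p b q) (step p (q ++ s) g)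

module _ {c ℓ : Level} (R : CommutativeRing c ℓ) where
  open FreeAlg R
  open CommutativeRing R hiding (refl)
  open import Algebra.Properties.Ring ring using (-1*x≈-x; -‿involutive)
  open SetoidReasoning setoid

  relatorGen : ∀ {a b} → Relator a b → Gen
  relatorGen (uu-comm i j i≥1 j≥1 far) = uu i j i≥1 j≥1 far
  relatorGen (dd-comm i j i≥1 j≥1 far) = dd i j i≥1 j≥1 far
  relatorGen (du-comm i j i≥1 j≥1 i≢j) = du i j i≥1 j≥1 i≢j
  relatorGen d₁u₁                      = d1u1
  relatorGen (du-shift i i≥1)          = dudu i i≥1

  gen-relatorGen : ∀ {a b} (g : Relator a b) → gen (relatorGen g) ≡ mon a ⊖ mon b
  gen-relatorGen (uu-comm _ _ _ _ _) = refl
  gen-relatorGen (dd-comm _ _ _ _ _) = refl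
  gen-relatorGen (du-comm _ _ _ _ _) = refl
  gen-relatorGen d₁u₁                = refl
  gen-relatorGen (du-shift _ _)      = refl

  δ : Word → Word → Carrier
  δ x v with x ≟W v
  ... | yes _ = 1#
  ... | no _  = 0#

  coeff-∷ : ∀ r x f v → coeff ((r , x) ∷ f) v ≈ r * δ x v + coeff f v
  coeff-∷ r x f v with x ≟W v
  ... | yes _ = +-congʳ (sym (*-identityʳ r))
  ... | no _  = sym (trans (+-congʳ (zeroʳ r)) (+-identityˡ _))

  coeff-pair : ∀ r s x y f v → coeff ((r , x) ∷ (s , y) ∷ f) v ≈ (r * δ x v + s * δ y v) + coeff f v
  coeff-pair r s x y f v = begin
    coeff ((r , x) ∷ (s , y) ∷ f) v     ≈⟨ coeff-∷ r x _ v ⟩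
    r * δ x v + coeff ((s , y) ∷ f) v   ≈⟨ +-congˡ (coeff-∷ s y f v) ⟩
    r * δ x v + (s * δ y v + coeff f v) ≈⟨ sym (+-assoc _ _ _) ⟩
    (r * δ x v + s * δ y v) + coeff f v ∎

  coeff-mon-⊖ : ∀ x y v → coeff (mon x ⊖ mon y) v ≈ δ x v - δ y v
  coeff-mon-⊖ x y v = begin
    coeff (mon x ⊖ mon y) v          ≈⟨ coeff-pair 1# (- 1#) x y [] v ⟩
    (1# * δ x v + - 1# * δ y v) + 0# ≈⟨ +-identityʳ _ ⟩
    1# * δ x v + - 1# * δ y v        ≈⟨ +-cong (*-identityˡ _) (-1*x≈-x _) ⟩
    δ x v - δ y v                    ∎

  Term : Set c
  Term = Carrier × Word × Gen × Word

  stepTerm : ∀ {x y} → SymClosure Step x y → Term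
  stepTerm (fwd (step p q g)) = 1# , p , relatorGen g , q
  stepTerm (bwd (step p q g)) = - 1# , p , relatorGen g , q

  coeff-stepTerm : ∀ {x y} (s : SymClosure Step x y) ts v →
                   coeff (combo (stepTerm s ∷ ts)) v ≈ (δ x v - δ y v) + coeff (combo ts) v
  coeff-stepTerm (fwd (step p q {a} {b} g)) ts v rewrite gen-relatorGen g = begin
    coeff ((1# * 1# , p ++ a ++ q) ∷ (1# * - 1# , p ++ b ++ q) ∷ combo ts) v
      ≈⟨ coeff-pair (1# * 1#) (1# * - 1#) (p ++ a ++ q) (p ++ b ++ q) (combo ts) v ⟩
    ((1# * 1#) * δ (p ++ a ++ q) v + (1# * - 1#) * δ (p ++ b ++ q) v) + coeff (combo ts) v
      ≈⟨ +-congʳ (+-cong (trans (*-congʳ (*-identityˡ 1#)) (*-identityˡ _))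
                         (trans (*-congʳ (*-identityˡ _)) (-1*x≈-x _))) ⟩
    (δ (p ++ a ++ q) v - δ (p ++ b ++ q) v) + coeff (combo ts) v ∎
  coeff-stepTerm (bwd (step p q {a} {b} g)) ts v rewrite gen-relatorGen g = begin
    coeff ((- 1# * 1# , p ++ a ++ q) ∷ (- 1# * - 1# , p ++ b ++ q) ∷ combo ts) v
      ≈⟨ coeff-pair (- 1# * 1#) (- 1# * - 1#) (p ++ a ++ q) (p ++ b ++ q) (combo ts) v ⟩
    ((- 1# * 1#) * δ (p ++ a ++ q) v + (- 1# * - 1#) * δ (p ++ b ++ q) v) + coeff (combo ts) v
      ≈⟨ +-congʳ (+-cong (trans (*-congʳ (*-identityʳ _)) (-1*x≈-x _))
                         (trans (*-congʳ (trans (-1*x≈-x _) (-‿involutive 1#))) (*-identityˡ _))) ⟩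
    (- δ (p ++ a ++ q) v + δ (p ++ b ++ q) v) + coeff (combo ts) v
      ≈⟨ +-congʳ (+-comm _ _) ⟩
    (δ (p ++ b ++ q) v - δ (p ++ a ++ q) v) + coeff (combo ts) v ∎

  derivationTerms : ∀ {x y} → x ≈ᴶ y → List Term
  derivationTerms ε        = []
  derivationTerms (s ◅ xs) = stepTerm s ∷ derivationTerms xs

  telescope : ∀ X Y Z → (X - Y) + (Y - Z) ≈ X - Z
  telescope X Y Z = begin
    (X - Y) + (Y - Z)   ≈⟨ +-assoc _ _ _ ⟩
    X + (- Y + (Y - Z)) ≈⟨ +-congˡ (sym (+-assoc _ _ _)) ⟩
    X + ((- Y + Y) - Z) ≈⟨ +-congˡ (+-congʳ (-‿inverseˡ Y)) ⟩
    X + (0# - Z)        ≈⟨ +-congˡ (+-identityˡ _) ⟩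
    X - Z               ∎

  coeff-derivationTerms : ∀ {x y} (xs : x ≈ᴶ y) v →
                          coeff (combo (derivationTerms xs)) v ≈ δ x v - δ y v
  coeff-derivationTerms {x} ε v = sym (-‿inverseʳ (δ x v))
  coeff-derivationTerms {x} {z} (_◅_ {j = y} s xs) v = begin
    coeff (combo (stepTerm s ∷ derivationTerms xs)) v      ≈⟨ coeff-stepTerm s (derivationTerms xs) v ⟩
    (δ x v - δ y v) + coeff (combo (derivationTerms xs)) v ≈⟨ +-congˡ (coeff-derivationTerms xs v) ⟩
    (δ x v - δ y v) + (δ y v - δ z v)                      ≈⟨ telescope _ _ _ ⟩
    δ x v - δ z v                                          ∎

  ≈ᴶ⇒InJ : ∀ {x y} → x ≈ᴶ y → InJ (mon x ⊖ mon y)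
  ≈ᴶ⇒InJ {x} {y} xs = derivationTerms xs , λ v →
    trans (coeff-mon-⊖ x y v) (sym (coeff-derivationTerms xs v))

flipLetter : Letter → Letter
flipLetter (u i) = d i
flipLetter (d i) = u i

-- The anti-automorphism u_i ↦ d_i, d_i ↦ u_i of 𝒰, which maps J to itself.
mirror : Word → Word
mirror = reverse ∘ map flipLetter

mirror-++ : ∀ x y → mirror (x ++ y) ≡ mirror y ++ mirror x
mirror-++ x y = ≡.trans (cong reverse (map-++ flipLetter x y))
  (reverse-++ (map flipLetter x) (map flipLetter y))

mirror-relator : ∀ {a b} → Relator a b → Relator (mirror a) (mirror b)
mirror-relator (uu-comm i j i≥1 j≥1 far) = dd-comm j i j≥1 i≥1 (swap far)
mirror-relator (dd-comm i j i≥1 j≥1 far) = uu-comm j i j≥1 i≥1 (swap far)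
mirror-relator (du-comm i j i≥1 j≥1 i≢j) = du-comm j i j≥1 i≥1 (i≢j ∘ ≡.sym)
mirror-relator d₁u₁                      = d₁u₁
mirror-relator (du-shift i i≥1)          = du-shift i i≥1

≈ᴶ-mirror : ∀ {x y} → x ≈ᴶ y → mirror x ≈ᴶ mirror y
≈ᴶ-mirror = EqClosure.gmap mirror mirror-step
  where
  mirror-context : ∀ p a q → mirror (p ++ a ++ q) ≡ mirror q ++ mirror a ++ mirror p
  mirror-context p a q = ≡.trans (mirror-++ p (a ++ q))
    (≡.trans (cong (_++ mirror p) (mirror-++ a q)) (++-assoc (mirror q) (mirror a) (mirror p)))

  mirror-step : ∀ {x y} → Step x y → Step (mirror x) (mirror y)
  mirror-step (step p q {a} {b} g) =
    subst₂ Step (≡.sym (mirror-context p a q)) (≡.sym (mirror-context p b q))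
      (step (mirror q) (mirror p) (mirror-relator g))

U : ℕ → Word
U zero    = []
U (suc k) = u (suc k) ∷ U k

D : ℕ → Word
D zero    = []
D (suc k) = D k ∷ʳ d (suc k)

mirror-U : ∀ k → mirror (U k) ≡ D k
mirror-U zero    = refl
mirror-U (suc k) = ≡.trans (mirror-++ [ u (suc k) ] (U k)) (cong (_∷ʳ d (suc k)) (mirror-U k))

mirror-D : ∀ k → mirror (D k) ≡ U k
mirror-D zero    = refl
mirror-D (suc k) = ≡.trans (mirror-++ (D k) [ d (suc k) ]) (cong (u (suc k) ∷_) (mirror-D k))

Commute : Word → Word → Set
Commute a b = a ++ b ≈ᴶ b ++ a

commute-sym : ∀ {a b} → Commute a b → Commute b a
commute-sym = ≈ᴶ-sym

commute-[]ʳ : ∀ a → Commute a []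
commute-[]ʳ a = ≡⇒≈ᴶ (++-identityʳ a)

commute-++ʳ : ∀ a {b₁ b₂} → Commute a b₁ → Commute a b₂ → Commute a (b₁ ++ b₂)
commute-++ʳ a {b₁} {b₂} ab₁ ab₂ = begin
  a ++ b₁ ++ b₂   ≡⟨ ≡.sym (++-assoc a b₁ b₂) ⟩
  (a ++ b₁) ++ b₂ ≈⟨ ≈ᴶ-suffix b₂ ab₁ ⟩
  (b₁ ++ a) ++ b₂ ≡⟨ ++-assoc b₁ a b₂ ⟩
  b₁ ++ a ++ b₂   ≈⟨ ≈ᴶ-prefix b₁ ab₂ ⟩
  b₁ ++ b₂ ++ a   ≡⟨ ≡.sym (++-assoc b₁ b₂ a) ⟩
  (b₁ ++ b₂) ++ a ∎
  where open ≈ᴶ-Reasoning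

commute-++ˡ : ∀ {a₁ a₂} b → Commute a₁ b → Commute a₂ b → Commute (a₁ ++ a₂) b
commute-++ˡ {a₁} {a₂} b a₁b a₂b =
  commute-sym {b} (commute-++ʳ b (commute-sym {a₁} a₁b) (commute-sym {a₂} a₂b))

mirror-commute : ∀ {a b} → Commute a b → Commute (mirror b) (mirror a)
mirror-commute {a} {b} ab = subst₂ _≈ᴶ_ (mirror-++ a b) (mirror-++ b a) (≈ᴶ-mirror ab)

U-commute : ∀ {w} k → (∀ {i} → 1 ≤ i → i ≤ k → Commute [ u i ] w) → Commute (U k) w
U-commute {w} zero    h = commute-sym {w} (commute-[]ʳ w)
U-commute {w} (suc k) h =
  commute-++ˡ {[ u (suc k) ]} w (h (s≤s z≤n) ℕP.≤-refl)
    (U-commute k (λ i≥1 i≤k → h i≥1 (ℕP.m≤n⇒m≤1+n i≤k)))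

D-commute : ∀ {w} k → (∀ {i} → 1 ≤ i → i ≤ k → Commute [ d i ] w) → Commute (D k) w
D-commute {w} zero    h = commute-sym {w} (commute-[]ʳ w)
D-commute {w} (suc k) h =
  commute-++ˡ {D k} w (D-commute k (λ i≥1 i≤k → h i≥1 (ℕP.m≤n⇒m≤1+n i≤k)))
    (h (s≤s z≤n) ℕP.≤-refl)

u-comm-u : ∀ {i j} → 1 ≤ i → 2 ℕ.+ i ≤ j → Commute [ u i ] [ u j ]
u-comm-u i≥1 far = relator⇒≈ᴶ (uu-comm _ _ i≥1 (ℕP.≤-trans (s≤s z≤n) far) (inj₁ far))

d-comm-d : ∀ {i j} → 1 ≤ i → 2 ℕ.+ i ≤ j → Commute [ d i ] [ d j ]
d-comm-d i≥1 far = relator⇒≈ᴶ (dd-comm _ _ i≥1 (ℕP.≤-trans (s≤s z≤n) far) (inj₁ far))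

d-comm-u : ∀ {i j} → 1 ≤ i → 1 ≤ j → i ≢ j → Commute [ d i ] [ u j ]
d-comm-u i≥1 j≥1 i≢j = relator⇒≈ᴶ (du-comm _ _ i≥1 j≥1 i≢j)

D-comm-u : ∀ {k j} → k < j → Commute (D k) [ u j ]
D-comm-u {k} k<j = D-commute k (λ i≥1 i≤k →
  d-comm-u i≥1 (ℕP.≤-trans (s≤s z≤n) k<j) (ℕP.<⇒≢ (ℕP.≤-<-trans i≤k k<j)))

D-comm-d : ∀ {k j} → suc k < j → Commute (D k) [ d j ]
D-comm-d {k} k+1<j =
  D-commute k (λ i≥1 i≤k → d-comm-d i≥1 (ℕP.≤-trans (s≤s (s≤s i≤k)) k+1<j))

U-comm-u : ∀ {k j} → suc k < j → Commute (U k) [ u j ]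
U-comm-u {k} k+1<j =
  U-commute k (λ i≥1 i≤k → u-comm-u i≥1 (ℕP.≤-trans (s≤s (s≤s i≤k)) k+1<j))

U-comm-d : ∀ {k j} → k < j → Commute (U k) [ d j ]
U-comm-d {k} {j} k<j = U-commute k (λ i≥1 i≤k → commute-sym {[ d j ]}
  (d-comm-u (ℕP.≤-trans (s≤s z≤n) k<j) i≥1 (ℕP.<⇒≢ (ℕP.≤-<-trans i≤k k<j) ∘ ≡.sym)))

du≈ud : ∀ k → d (2 ℕ.+ k) ∷ u (2 ℕ.+ k) ∷ [] ≈ᴶ u (suc k) ∷ d (suc k) ∷ []
du≈ud k = relator⇒≈ᴶ (du-shift (suc k) (s≤s z≤n))

d-cancels-U : ∀ k → d (suc k) ∷ U (suc k) ≈ᴶ U k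
d-cancels-U zero    = relator⇒≈ᴶ d₁u₁
d-cancels-U (suc k) = begin
  d (2 ℕ.+ k) ∷ u (2 ℕ.+ k) ∷ U (suc k) ≈⟨ ≈ᴶ-suffix (U (suc k)) (du≈ud k) ⟩
  u (suc k) ∷ d (suc k) ∷ U (suc k)     ≈⟨ ≈ᴶ-prefix [ u (suc k) ] (d-cancels-U k) ⟩
  u (suc k) ∷ U k                       ∎
  where open ≈ᴶ-Reasoning

D-cancels-U : ∀ k → D k ++ U k ≈ᴶ []
D-cancels-U zero    = ε
D-cancels-U (suc k) = begin
  (D k ∷ʳ d (suc k)) ++ U (suc k) ≡⟨ ++-assoc (D k) _ _ ⟩
  D k ++ d (suc k) ∷ U (suc k)    ≈⟨ ≈ᴶ-prefix (D k) (d-cancels-U k) ⟩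
  D k ++ U k                      ≈⟨ D-cancels-U k ⟩
  []                              ∎
  where open ≈ᴶ-Reasoning

u≈D++U : ∀ k → [ u (suc k) ] ≈ᴶ D k ++ U (suc k)
u≈D++U k = begin
  [ u (suc k) ]                 ≈⟨ ≈ᴶ-prefix [ u (suc k) ] (≈ᴶ-sym (D-cancels-U k)) ⟩
  [ u (suc k) ] ++ D k ++ U k   ≡⟨ ≡.sym (++-assoc [ u (suc k) ] (D k) (U k)) ⟩
  ([ u (suc k) ] ++ D k) ++ U k ≈⟨ ≈ᴶ-suffix (U k) (≈ᴶ-sym (D-comm-u ℕP.≤-refl)) ⟩
  (D k ++ [ u (suc k) ]) ++ U k ≡⟨ ++-assoc (D k) _ (U k) ⟩
  D k ++ U (suc k)              ∎
  where open ≈ᴶ-Reasoning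

d≈D++U : ∀ k → [ d (suc k) ] ≈ᴶ D (suc k) ++ U k
d≈D++U k = begin
  [ d (suc k) ]                 ≈⟨ ≈ᴶ-suffix [ d (suc k) ] (≈ᴶ-sym (D-cancels-U k)) ⟩
  (D k ++ U k) ++ [ d (suc k) ] ≡⟨ ++-assoc (D k) (U k) _ ⟩
  D k ++ U k ++ [ d (suc k) ]   ≈⟨ ≈ᴶ-prefix (D k) (U-comm-d ℕP.≤-refl) ⟩
  D k ++ d (suc k) ∷ U k        ≡⟨ ≡.sym (++-assoc (D k) _ (U k)) ⟩
  D (suc k) ++ U k              ∎
  where open ≈ᴶ-Reasoning

du-comm-U : ∀ {i j} → suc i < j → Commute (d j ∷ u j ∷ []) (U i)
du-comm-U {i} i+1<j = commute-++ˡ (U i)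
  (commute-sym {U i} (U-comm-d (ℕP.<-trans (ℕP.n<1+n i) i+1<j))) (commute-sym {U i} (U-comm-u i+1<j))

du-comm-D : ∀ k → Commute (d (2 ℕ.+ k) ∷ u (2 ℕ.+ k) ∷ []) (D k)
du-comm-D k = commute-++ˡ (D k)
  (commute-sym {D k} (D-comm-d ℕP.≤-refl)) (commute-sym {D k} (D-comm-u (ℕP.n≤1+n (suc k))))

udu≈u : ∀ k → u (suc k) ∷ d (suc k) ∷ u (suc k) ∷ [] ≈ᴶ [ u (suc k) ]
udu≈u k = begin
  u (suc k) ∷ d (suc k) ∷ u (suc k) ∷ [] ≈⟨ ≈ᴶ-suffix [ u (suc k) ] (≈ᴶ-sym (du≈ud k)) ⟩
  du ++ [ u (suc k) ]                    ≈⟨ ≈ᴶ-prefix du (u≈D++U k) ⟩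
  du ++ D k ++ U (suc k)                 ≡⟨ ≡.sym (++-assoc du (D k) _) ⟩
  (du ++ D k) ++ U (suc k)               ≈⟨ ≈ᴶ-suffix (U (suc k)) (du-comm-D k) ⟩
  (D k ++ du) ++ U (suc k)               ≡⟨ ++-assoc (D k) du _ ⟩
  D k ++ d (2 ℕ.+ k) ∷ U (2 ℕ.+ k)       ≈⟨ ≈ᴶ-prefix (D k) (d-cancels-U (suc k)) ⟩
  D k ++ U (suc k)                       ≈⟨ ≈ᴶ-sym (u≈D++U k) ⟩
  [ u (suc k) ]                          ∎
  where
  open ≈ᴶ-Reasoning
  du : Word
  du = d (2 ℕ.+ k) ∷ u (2 ℕ.+ k) ∷ []

U-suc++D : ∀ k → U (suc k) ++ D k ≈ᴶ [ u (suc k) ]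
U-suc++D zero    = ε
U-suc++D (suc k) = begin
  u (2 ℕ.+ k) ∷ U (suc k) ++ D k ∷ʳ d (suc k)
    ≡⟨ cong (u (2 ℕ.+ k) ∷_) (≡.sym (++-assoc (U (suc k)) (D k) _)) ⟩
  u (2 ℕ.+ k) ∷ (U (suc k) ++ D k) ++ [ d (suc k) ]
    ≈⟨ ≈ᴶ-prefix [ u (2 ℕ.+ k) ] (≈ᴶ-suffix [ d (suc k) ] (U-suc++D k)) ⟩
  u (2 ℕ.+ k) ∷ u (suc k) ∷ d (suc k) ∷ []
    ≈⟨ ≈ᴶ-prefix [ u (2 ℕ.+ k) ] (≈ᴶ-sym (du≈ud k)) ⟩
  u (2 ℕ.+ k) ∷ d (2 ℕ.+ k) ∷ u (2 ℕ.+ k) ∷ []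
    ≈⟨ udu≈u (suc k) ⟩
  [ u (2 ℕ.+ k) ] ∎
  where open ≈ᴶ-Reasoning

U-comm-U : ∀ {i j} → i ≤ j → Commute (U i) (U j)
U-comm-U {j = zero}  z≤n = ε
U-comm-U {i} {suc j} i≤1+j with ℕP.m≤n⇒m<n∨m≡n i≤1+j
... | inj₂ refl       = ε
... | inj₁ (s≤s i≤j) = begin
  U i ++ U (suc j)
    ≈⟨ ≈ᴶ-prefix (U i) (≈ᴶ-sym (d-cancels-U (suc j))) ⟩
  U i ++ d (2 ℕ.+ j) ∷ u (2 ℕ.+ j) ∷ U (suc j)
    ≡⟨ ≡.sym (++-assoc (U i) (d (2 ℕ.+ j) ∷ u (2 ℕ.+ j) ∷ []) _) ⟩
  (U i ++ d (2 ℕ.+ j) ∷ u (2 ℕ.+ j) ∷ []) ++ U (suc j)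
    ≈⟨ ≈ᴶ-suffix (U (suc j)) (≈ᴶ-sym (du-comm-U (s≤s (s≤s i≤j)))) ⟩
  d (2 ℕ.+ j) ∷ u (2 ℕ.+ j) ∷ U i ++ U (suc j)
    ≈⟨ ≈ᴶ-suffix (U i ++ U (suc j)) (du≈ud j) ⟩
  u (suc j) ∷ (d (suc j) ∷ U i) ++ U (suc j)
    ≈⟨ ≈ᴶ-prefix [ u (suc j) ] (≈ᴶ-suffix (U (suc j)) (≈ᴶ-sym (U-comm-d (s≤s i≤j)))) ⟩
  u (suc j) ∷ (U i ++ [ d (suc j) ]) ++ U (suc j)
    ≡⟨ cong (u (suc j) ∷_) (++-assoc (U i) _ _) ⟩
  u (suc j) ∷ U i ++ d (suc j) ∷ U (suc j)
    ≈⟨ ≈ᴶ-prefix (u (suc j) ∷ U i) (d-cancels-U j) ⟩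
  u (suc j) ∷ U i ++ U j
    ≈⟨ ≈ᴶ-prefix [ u (suc j) ] (U-comm-U i≤j) ⟩
  U (suc j) ++ U i ∎
  where open ≈ᴶ-Reasoning

D-comm-U< : ∀ {i j} → i < j → Commute (D i) (U j)
D-comm-U< {i} {suc j} (s≤s i≤j) with ℕP.m≤n⇒m<n∨m≡n i≤j
... | inj₂ refl = begin
  D i ++ u (suc i) ∷ U i        ≡⟨ ≡.sym (++-assoc (D i) _ _) ⟩
  (D i ++ [ u (suc i) ]) ++ U i ≈⟨ ≈ᴶ-suffix (U i) (D-comm-u ℕP.≤-refl) ⟩
  u (suc i) ∷ D i ++ U i        ≈⟨ ≈ᴶ-prefix [ u (suc i) ] (D-cancels-U i) ⟩
  [ u (suc i) ]                 ≈⟨ ≈ᴶ-sym (U-suc++D i) ⟩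
  U (suc i) ++ D i              ∎
  where open ≈ᴶ-Reasoning
... | inj₁ i<j = begin
  D i ++ u (suc j) ∷ U j        ≡⟨ ≡.sym (++-assoc (D i) _ _) ⟩
  (D i ++ [ u (suc j) ]) ++ U j ≈⟨ ≈ᴶ-suffix (U j) (D-comm-u (s≤s i≤j)) ⟩
  u (suc j) ∷ D i ++ U j        ≈⟨ ≈ᴶ-prefix [ u (suc j) ] (D-comm-U< i<j) ⟩
  U (suc j) ++ D i              ∎
  where open ≈ᴶ-Reasoning

D-comm-U : ∀ {i j} → i ≢ j → Commute (D i) (U j)
D-comm-U {i} {j} i≢j with ℕP.<-cmp i j
... | tri< i<j _ _ = D-comm-U< i<j
... | tri≈ _ i≡j _ = ⊥-elim (i≢j i≡j)
... | tri> _ _ j<i =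
  subst₂ Commute (mirror-U i) (mirror-D j) (mirror-commute {D j} {U i} (D-comm-U< j<i))

D-comm-D : ∀ {i j} → i ≤ j → Commute (D j) (D i)
D-comm-D {i} {j} i≤j =
  subst₂ Commute (mirror-U j) (mirror-U i) (mirror-commute {U i} {U j} (U-comm-U i≤j))

-- The pair (a , c) at index j stands for the factor U_j^a D_j^c of a normal form; pushU and
-- pushD record the effect of prepending U_j and D_j to that factor, using D_j U_j ≈ᴶ [].
Coord : Set
Coord = ℕ × ℕ

pushU : Coord → Coord
pushU (a , c) = suc a , c

pushD : Coord → Coord
pushD (suc a , c) = a , c
pushD (zero  , c) = zero , suc c

infixr 8 _^_
_^_ : Word → ℕ → Word
w ^ zero  = []
w ^ suc r = w ++ w ^ r

block : ℕ → Coord → Word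
block j (a , c) = U j ^ a ++ D j ^ c

normalForm : (ℕ → Coord) → ℕ → Word
normalForm s zero    = []
normalForm s (suc n) = normalForm s n ++ block (suc n) (s (suc n))

adjust : ℕ → (Coord → Coord) → (ℕ → Coord) → ℕ → Coord
adjust k f s j with j ℕ.≟ k
... | yes _ = f (s j)
... | no _  = s j

adjust-≡ : ∀ k f s → adjust k f s k ≡ f (s k)
adjust-≡ k f s with k ℕ.≟ k
... | yes _   = refl
... | no k≢k = ⊥-elim (k≢k refl)

adjust-≢ : ∀ {k j} f s → j ≢ k → adjust k f s j ≡ s j
adjust-≢ {k} {j} f s j≢k with j ℕ.≟ k
... | yes j≡k = ⊥-elim (j≢k j≡k)
... | no _    = refl

normalForm-cong : ∀ {s t} n → (∀ {j} → 1 ≤ j → j ≤ n → s j ≡ t j) →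
                  normalForm s n ≡ normalForm t n
normalForm-cong zero    s≗t = refl
normalForm-cong (suc n) s≗t =
  cong₂ _++_ (normalForm-cong n (λ j≥1 j≤n → s≗t j≥1 (ℕP.m≤n⇒m≤1+n j≤n)))
             (cong (block (suc n)) (s≗t (s≤s z≤n) ℕP.≤-refl))

commute-^ : ∀ y {w} r → Commute y w → Commute y (w ^ r)
commute-^ y zero    yw = commute-[]ʳ y
commute-^ y (suc r) yw = commute-++ʳ y yw (commute-^ y r yw)

commute-block : ∀ y j p → Commute y (U j) → Commute y (D j) → Commute y (block j p)
commute-block y j (a , c) yU yD = commute-++ʳ y (commute-^ y a yU) (commute-^ y c yD)

commute-normalForm : ∀ y s n → (∀ {i} → 1 ≤ i → i ≤ n → Commute y (U i) × Commute y (D i)) →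
                     Commute y (normalForm s n)
commute-normalForm y s zero    h = commute-[]ʳ y
commute-normalForm y s (suc n) h = commute-++ʳ y
  (commute-normalForm y s n (λ i≥1 i≤n → h i≥1 (ℕP.m≤n⇒m≤1+n i≤n)))
  (commute-block y (suc n) (s (suc n)) (proj₁ top) (proj₂ top))
  where top = h (s≤s z≤n) ℕP.≤-refl

prepend-normalForm : ∀ (Y : ℕ → Word) f → Y zero ≡ [] →
  (∀ {i k} → 1 ≤ i → i < k → Commute (Y k) (U i) × Commute (Y k) (D i)) →
  (∀ k p → Y k ++ block k p ≈ᴶ block k (f p)) →
  ∀ s n {k} → k ≤ n → Y k ++ normalForm s n ≈ᴶ normalForm (adjust k f s) n
prepend-normalForm Y f Y₀ commutes absorbs s zero    z≤n  = ≡⇒≈ᴶ (≡.trans (++-identityʳ _) Y₀)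
prepend-normalForm Y f Y₀ commutes absorbs s (suc n) {k} k≤1+n with ℕP.m≤n⇒m<n∨m≡n k≤1+n
... | inj₁ (s≤s k≤n) = begin
  Y k ++ normalForm s n ++ top (s (suc n))
    ≡⟨ ≡.sym (++-assoc (Y k) _ _) ⟩
  (Y k ++ normalForm s n) ++ top (s (suc n))
    ≈⟨ ≈ᴶ-suffix _ (prepend-normalForm Y f Y₀ commutes absorbs s n k≤n) ⟩
  normalForm (adjust k f s) n ++ top (s (suc n))
    ≡⟨ cong (λ p → normalForm (adjust k f s) n ++ top p)
            (≡.sym (adjust-≢ f s (ℕP.<⇒≢ (s≤s k≤n) ∘ ≡.sym))) ⟩
  normalForm (adjust k f s) (suc n) ∎
  where
  open ≈ᴶ-Reasoning
  top : Coord → Word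
  top = block (suc n)
... | inj₂ refl = begin
  Y k ++ normalForm s n ++ block k (s k)
    ≡⟨ ≡.sym (++-assoc (Y k) _ _) ⟩
  (Y k ++ normalForm s n) ++ block k (s k)
    ≈⟨ ≈ᴶ-suffix _ (commute-normalForm (Y k) s n (λ i≥1 i≤n → commutes i≥1 (s≤s i≤n))) ⟩
  (normalForm s n ++ Y k) ++ block k (s k)
    ≡⟨ ++-assoc (normalForm s n) _ _ ⟩
  normalForm s n ++ Y k ++ block k (s k)
    ≈⟨ ≈ᴶ-prefix (normalForm s n) (absorbs k (s k)) ⟩
  normalForm s n ++ block k (f (s k))
    ≡⟨ cong₂ _++_ (normalForm-cong n (λ _ j≤n → ≡.sym (adjust-≢ f s (ℕP.<⇒≢ (s≤s j≤n)))))
                  (cong (block k) (≡.sym (adjust-≡ k f s))) ⟩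
  normalForm (adjust k f s) k ∎
  where open ≈ᴶ-Reasoning

D-++-block : ∀ k p → D k ++ block k p ≈ᴶ block k (pushD p)
D-++-block k (zero  , c) = ε
D-++-block k (suc a , c) = begin
  D k ++ (U k ++ U k ^ a) ++ D k ^ c ≡⟨ cong (D k ++_) (++-assoc (U k) _ _) ⟩
  D k ++ U k ++ U k ^ a ++ D k ^ c   ≡⟨ ≡.sym (++-assoc (D k) (U k) _) ⟩
  (D k ++ U k) ++ U k ^ a ++ D k ^ c ≈⟨ ≈ᴶ-suffix _ (D-cancels-U k) ⟩
  U k ^ a ++ D k ^ c                 ∎
  where open ≈ᴶ-Reasoning

prepend-U : ∀ s n {k} → k ≤ n → U k ++ normalForm s n ≈ᴶ normalForm (adjust k pushU s) n
prepend-U = prepend-normalForm U pushU refl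
  (λ {i} {k} _ i<k →
    commute-sym {U i} (U-comm-U (ℕP.<⇒≤ i<k)) , commute-sym {D i} (D-comm-U (ℕP.<⇒≢ i<k)))
  (λ k → λ { (a , c) → ≡⇒≈ᴶ (≡.sym (++-assoc (U k) (U k ^ a) (D k ^ c))) })

prepend-D : ∀ s n {k} → k ≤ n → D k ++ normalForm s n ≈ᴶ normalForm (adjust k pushD s) n
prepend-D = prepend-normalForm D pushD refl
  (λ _ i<k → D-comm-U (ℕP.<⇒≢ i<k ∘ ≡.sym) , D-comm-D (ℕP.<⇒≤ i<k))
  D-++-block

onIndex : ℕ → ℕ → (Coord → Coord) → (Coord → Coord) → Coord → Coord
onIndex j k f g with j ℕ.≟ k | suc j ℕ.≟ k
... | yes _ | _     = f
... | no _  | yes _ = g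
... | no _  | no _  = λ p → p

-- Since u_k ≈ᴶ D_{k-1} U_k and d_k ≈ᴶ D_k U_{k-1}, only the letters of index j and j + 1
-- affect the factor of index j of a normal form.
letterStep : ℕ → Letter → Coord → Coord
letterStep j (u k) = onIndex j k pushU pushD
letterStep j (d k) = onIndex j k pushD pushU

coordsFrom : ℕ → Word → Coord → Coord
coordsFrom j x p = foldr (letterStep j) p x

coords : Word → ℕ → Coord
coords x j = coordsFrom j x (0 , 0)

n≢1+n : ∀ {n} → n ≢ suc n
n≢1+n ()

onIndex-self : ∀ j f g → onIndex j j f g ≡ f
onIndex-self j f g with j ℕ.≟ j | suc j ℕ.≟ j
... | yes _  | _ = refl
... | no j≢j | _ = ⊥-elim (j≢j refl)

onIndex-next : ∀ j f g → onIndex j (suc j) f g ≡ g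
onIndex-next j f g with j ℕ.≟ suc j | suc j ℕ.≟ suc j
... | yes j≡1+j | _       = ⊥-elim (n≢1+n j≡1+j)
... | no _      | yes _   = refl
... | no _      | no ≢refl = ⊥-elim (≢refl refl)

onIndex-other : ∀ {j k} f g → j ≢ k → suc j ≢ k → onIndex j k f g ≡ (λ p → p)
onIndex-other {j} {k} f g j≢k 1+j≢k with j ℕ.≟ k | suc j ℕ.≟ k
... | yes j≡k | _         = ⊥-elim (j≢k j≡k)
... | no _    | yes 1+j≡k = ⊥-elim (1+j≢k 1+j≡k)
... | no _    | no _      = refl

Away : ℕ → ℕ → Set
Away i k = k ≤ i ⊎ 2 ℕ.+ i < k

onIndex-away : ∀ {i k} f g → Away i k → onIndex (suc i) k f g ≡ (λ p → p)
onIndex-away f g (inj₁ k≤i) =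
  onIndex-other f g (ℕP.<⇒≢ (s≤s k≤i) ∘ ≡.sym) (ℕP.<⇒≢ (s≤s (ℕP.m≤n⇒m≤1+n k≤i)) ∘ ≡.sym)
onIndex-away f g (inj₂ i+2<k) =
  onIndex-other f g (ℕP.<⇒≢ (ℕP.<-trans (ℕP.n<1+n _) i+2<k)) (ℕP.<⇒≢ i+2<k)

adjust-adjacent : ∀ k f g s j → adjust k g (adjust (suc k) f s) j ≡ onIndex j (suc k) f g (s j)
adjust-adjacent k f g s j = by-cases (j ℕ.≟ suc k) (j ℕ.≟ k)
  where
  Goal : Set
  Goal = adjust k g (adjust (suc k) f s) j ≡ onIndex j (suc k) f g (s j)

  by-cases : Dec (j ≡ suc k) → Dec (j ≡ k) → Goal
  by-cases (yes refl) _ = ≡.trans (adjust-≢ {k} g (adjust (suc k) f s) (n≢1+n ∘ ≡.sym))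
    (≡.trans (adjust-≡ (suc k) f s) (≡.sym (≡.cong-app (onIndex-self j f g) (s j))))
  by-cases (no j≢1+k) (yes refl) = ≡.trans (adjust-≡ j g _)
    (≡.trans (cong g (adjust-≢ f s j≢1+k)) (≡.sym (≡.cong-app (onIndex-next j f g) (s j))))
  by-cases (no j≢1+k) (no j≢k) = ≡.trans (adjust-≢ {k} g (adjust (suc k) f s) j≢k)
    (≡.trans (adjust-≢ f s j≢1+k) (≡.sym (≡.cong-app (onIndex-other f g j≢1+k (j≢k ∘ ℕP.suc-injective)) (s j))))

adjust-adjacent′ : ∀ k f g s j → adjust (suc k) f (adjust k g s) j ≡ onIndex j (suc k) f g (s j)
adjust-adjacent′ k f g s j = by-cases (j ℕ.≟ suc k) (j ℕ.≟ k)
  where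
  Goal : Set
  Goal = adjust (suc k) f (adjust k g s) j ≡ onIndex j (suc k) f g (s j)

  by-cases : Dec (j ≡ suc k) → Dec (j ≡ k) → Goal
  by-cases (yes refl) _ = ≡.trans (adjust-≡ (suc k) f _)
    (≡.trans (cong f (adjust-≢ g s (n≢1+n ∘ ≡.sym))) (≡.sym (≡.cong-app (onIndex-self j f g) (s j))))
  by-cases (no j≢1+k) (yes refl) = ≡.trans (adjust-≢ {suc k} f (adjust k g s) j≢1+k)
    (≡.trans (adjust-≡ j g s) (≡.sym (≡.cong-app (onIndex-next j f g) (s j))))
  by-cases (no j≢1+k) (no j≢k) = ≡.trans (adjust-≢ {suc k} f (adjust k g s) j≢1+k)
    (≡.trans (adjust-≢ g s j≢k) (≡.sym (≡.cong-app (onIndex-other f g j≢1+k (j≢k ∘ ℕP.suc-injective)) (s j))))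

IndicesIn : ℕ → Word → Set
IndicesIn n = All (λ c → 1 ≤ idx c × idx c ≤ n)

normalForm-empty : ∀ n → normalForm (λ _ → (0 , 0)) n ≡ []
normalForm-empty zero    = refl
normalForm-empty (suc n) = ≡.trans (++-identityʳ _) (normalForm-empty n)

≈ᴶ-normalForm : ∀ n x → IndicesIn n x → x ≈ᴶ normalForm (coords x) n
≈ᴶ-normalForm n [] [] = ≡⇒≈ᴶ (≡.sym (normalForm-empty n))
≈ᴶ-normalForm n (u (suc k) ∷ x) ((_ , k+1≤n) ∷ xs) = begin
  u (suc k) ∷ x
    ≈⟨ ≈ᴶ-prefix [ u (suc k) ] (≈ᴶ-normalForm n x xs) ⟩
  [ u (suc k) ] ++ normalForm (coords x) n
    ≈⟨ ≈ᴶ-suffix _ (u≈D++U k) ⟩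
  (D k ++ U (suc k)) ++ normalForm (coords x) n
    ≡⟨ ++-assoc (D k) _ _ ⟩
  D k ++ U (suc k) ++ normalForm (coords x) n
    ≈⟨ ≈ᴶ-prefix (D k) (prepend-U (coords x) n k+1≤n) ⟩
  D k ++ normalForm (adjust (suc k) pushU (coords x)) n
    ≈⟨ prepend-D _ n (ℕP.<⇒≤ k+1≤n) ⟩
  normalForm (adjust k pushD (adjust (suc k) pushU (coords x))) n
    ≡⟨ normalForm-cong n (λ {j} _ _ → adjust-adjacent k pushU pushD (coords x) j) ⟩
  normalForm (coords (u (suc k) ∷ x)) n ∎
  where open ≈ᴶ-Reasoning
≈ᴶ-normalForm n (d (suc k) ∷ x) ((_ , k+1≤n) ∷ xs) = begin
  d (suc k) ∷ x
    ≈⟨ ≈ᴶ-prefix [ d (suc k) ] (≈ᴶ-normalForm n x xs) ⟩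
  [ d (suc k) ] ++ normalForm (coords x) n
    ≈⟨ ≈ᴶ-suffix _ (d≈D++U k) ⟩
  (D (suc k) ++ U k) ++ normalForm (coords x) n
    ≡⟨ ++-assoc (D (suc k)) _ _ ⟩
  D (suc k) ++ U k ++ normalForm (coords x) n
    ≈⟨ ≈ᴶ-prefix (D (suc k)) (prepend-U (coords x) n (ℕP.<⇒≤ k+1≤n)) ⟩
  D (suc k) ++ normalForm (adjust k pushU (coords x)) n
    ≈⟨ prepend-D _ n k+1≤n ⟩
  normalForm (adjust (suc k) pushD (adjust k pushU (coords x))) n
    ≡⟨ normalForm-cong n (λ {j} _ _ → adjust-adjacent′ k pushD pushU (coords x) j) ⟩
  normalForm (coords (d (suc k) ∷ x)) n ∎
  where open ≈ᴶ-Reasoning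

open import Data.Integer using (_+_; _-_; _⊔_)

Represents : Coord → ℤ → ℤ → Set
Represents (K , C) A Δ = (+ C ≡ A) × (+ K ≡ A - Δ)

private
  split-difference : ∀ A Δ → A ≡ Δ + (A - Δ)
  split-difference = solve-∀

  shift-down : ∀ A Δ → 1ℤ + (A - Δ) ≡ A - (Δ - 1ℤ)
  shift-down = solve-∀

  shift-up : ∀ A Δ → (A - Δ) - 1ℤ ≡ A - (Δ + 1ℤ)
  shift-up = solve-∀

  cancel-one : ∀ K → K ≡ (1ℤ + K) - 1ℤ
  cancel-one = solve-∀

  add-one : ∀ Δ → 1ℤ + (Δ + + 0) ≡ Δ + 1ℤ
  add-one = solve-∀

difference⇒sum : ∀ {K A Δ} → + K ≡ A - Δ → Δ + + K ≡ A
difference⇒sum {K} {A} {Δ} K≡A-Δ =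
  ≡.sym (≡.trans (split-difference A Δ) (cong (λ t → Δ + t) (≡.sym K≡A-Δ)))

difference⇒≤ : ∀ {K A Δ} → + K ≡ A - Δ → Δ ≤ℤ A
difference⇒≤ {K} {A} {Δ} K≡A-Δ =
  ℤP.≤-trans (ℤP.i≤i+j Δ (+ K)) (ℤP.≤-reflexive (difference⇒sum K≡A-Δ))

represents-id : ∀ {p A Δ} → Represents p A Δ → Represents p (Δ ⊔ A) Δ
represents-id {K , C} {A} {Δ} (C≡A , K≡A-Δ) =
  ≡.trans C≡A (≡.sym max) , ≡.trans K≡A-Δ (cong (_- Δ) (≡.sym max))
  where
  max : Δ ⊔ A ≡ A
  max = ℤP.i≤j⇒i⊔j≡j (difference⇒≤ K≡A-Δ)

represents-pushU : ∀ {p A Δ Δ′} → Δ′ ≡ Δ - 1ℤ → Represents p A Δ →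
                   Represents (pushU p) (Δ′ ⊔ A) Δ′
represents-pushU {K , C} {A} {Δ} refl (C≡A , K≡A-Δ) = ≡.trans C≡A (≡.sym max) , (begin
  1ℤ + + K                  ≡⟨ cong (λ t → 1ℤ + t) K≡A-Δ ⟩
  1ℤ + (A - Δ)              ≡⟨ shift-down A Δ ⟩
  A - (Δ - 1ℤ)              ≡⟨ cong (_- (Δ - 1ℤ)) (≡.sym max) ⟩
  (Δ - 1ℤ) ⊔ A - (Δ - 1ℤ)   ∎)
  where
  open ≡.≡-Reasoning
  max : (Δ - 1ℤ) ⊔ A ≡ A
  max = ℤP.i≤j⇒i⊔j≡j (ℤP.≤-trans (ℤP.i-j≤i Δ 1ℤ) (difference⇒≤ K≡A-Δ))

represents-pushD : ∀ {p A Δ Δ′} → Δ′ ≡ Δ + 1ℤ → Represents p A Δ →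
                   Represents (pushD p) (Δ′ ⊔ A) Δ′
represents-pushD {suc K , C} {A} {Δ} refl (C≡A , K+1≡A-Δ) = ≡.trans C≡A (≡.sym max) , (begin
  + K                       ≡⟨ cancel-one (+ K) ⟩
  1ℤ + + K - 1ℤ             ≡⟨ cong (_- 1ℤ) K+1≡A-Δ ⟩
  (A - Δ) - 1ℤ              ≡⟨ shift-up A Δ ⟩
  A - (Δ + 1ℤ)              ≡⟨ cong (_- (Δ + 1ℤ)) (≡.sym max) ⟩
  (Δ + 1ℤ) ⊔ A - (Δ + 1ℤ)   ∎)
  where
  open ≡.≡-Reasoning
  max : (Δ + 1ℤ) ⊔ A ≡ A
  max = ℤP.i≤j⇒i⊔j≡j (ℤP.≤-trans (ℤP.+-monoʳ-≤ Δ (+≤+ᶻ (s≤s z≤n)))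
                                  (ℤP.≤-reflexive (difference⇒sum K+1≡A-Δ)))
represents-pushD {zero , C} {A} {Δ} refl (C≡A , 0≡A-Δ) = (begin
  1ℤ + + C                  ≡⟨ cong (λ t → 1ℤ + t) (≡.trans C≡A (≡.sym Δ≡A)) ⟩
  1ℤ + (Δ + + 0)            ≡⟨ add-one Δ ⟩
  Δ + 1ℤ                    ≡⟨ ≡.sym max ⟩
  (Δ + 1ℤ) ⊔ A              ∎) ,
  ≡.sym (≡.trans (cong (_- (Δ + 1ℤ)) max) (ℤP.+-inverseʳ (Δ + 1ℤ)))
  where
  open ≡.≡-Reasoning
  Δ≡A : Δ + + 0 ≡ A
  Δ≡A = difference⇒sum 0≡A-Δ
  max : (Δ + 1ℤ) ⊔ A ≡ Δ + 1ℤ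
  max = ℤP.i≥j⇒i⊔j≡i (ℤP.≤-trans (ℤP.≤-reflexive (≡.sym Δ≡A)) (ℤP.+-monoʳ-≤ Δ (+≤+ᶻ z≤n)))

private
  Δ-down : ∀ a b → a - (1ℤ + b) ≡ (a - b) - 1ℤ
  Δ-down = solve-∀

  Δ-down′ : ∀ a b → (-1ℤ + a) - b ≡ (a - b) - 1ℤ
  Δ-down′ = solve-∀

  Δ-up : ∀ a b → (1ℤ + a) - b ≡ (a - b) + 1ℤ
  Δ-up = solve-∀

  Δ-up′ : ∀ a b → a - (-1ℤ + b) ≡ (a - b) + 1ℤ
  Δ-up′ = solve-∀

coords-represents : ∀ j x → Represents (coords x j) (α j x) (w (suc j) x - w j x)
coords-represents j [] = refl , refl
coords-represents j (u k ∷ x) with j ℕ.≟ k | suc j ℕ.≟ k | coords-represents j x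
... | yes refl | yes 1+j≡j | _ = ⊥-elim (n≢1+n (≡.sym 1+j≡j))
... | yes refl | no _      | r = represents-pushU (Δ-down (w (suc j) x) (w j x)) r
... | no _     | yes refl  | r = represents-pushD (Δ-up (w (suc j) x) (w j x)) r
... | no _     | no _      | r = represents-id r
coords-represents j (d k ∷ x) with j ℕ.≟ k | suc j ℕ.≟ k | coords-represents j x
... | yes refl | yes 1+j≡j | _ = ⊥-elim (n≢1+n (≡.sym 1+j≡j))
... | yes refl | no _      | r = represents-pushD (Δ-up′ (w (suc j) x) (w j x)) r
... | no _     | yes refl  | r = represents-pushU (Δ-down′ (w (suc j) x) (w j x)) r
... | no _     | no _      | r = represents-id r

coordsFrom-++ : ∀ j x y p → coordsFrom j (x ++ y) p ≡ coordsFrom j x (coordsFrom j y p)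
coordsFrom-++ j x y p = foldr-++ (letterStep j) p x y

module _ {j : ℕ} {c : Letter} where

  replicate-inert : letterStep j c ≡ (λ p → p) → ∀ r p → coordsFrom j (replicate r c) p ≡ p
  replicate-inert step≡id zero    p = refl
  replicate-inert step≡id (suc r) p rewrite step≡id = replicate-inert step≡id r p

  replicate-pushU : letterStep j c ≡ pushU →
                    ∀ r a c′ → coordsFrom j (replicate r c) (a , c′) ≡ (a ℕ.+ r , c′)
  replicate-pushU step≡pushU zero    a c′ = cong (_, c′) (≡.sym (ℕP.+-identityʳ a))
  replicate-pushU step≡pushU (suc r) a c′ rewrite step≡pushU | replicate-pushU step≡pushU r a c′ =
    cong (_, c′) (≡.sym (ℕP.+-suc a r))

  replicate-pushD : letterStep j c ≡ pushD →
                    ∀ r K c′ → coordsFrom j (replicate r c) (K ℕ.+ r , c′) ≡ (K , c′)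
  replicate-pushD step≡pushD zero    K c′ = cong (_, c′) (ℕP.+-identityʳ K)
  replicate-pushD step≡pushD (suc r) K c′
    rewrite step≡pushD | ℕP.+-suc K r | replicate-pushD step≡pushD r (suc K) c′ = refl

  replicate-pushD-zero : letterStep j c ≡ pushD →
                         ∀ r c′ → coordsFrom j (replicate r c) (0 , c′) ≡ (0 , c′ ℕ.+ r)
  replicate-pushD-zero step≡pushD zero    c′ = cong (0 ,_) (≡.sym (ℕP.+-identityʳ c′))
  replicate-pushD-zero step≡pushD (suc r) c′
    rewrite step≡pushD | replicate-pushD-zero step≡pushD r c′ =
    cong (0 ,_) (≡.sym (ℕP.+-suc c′ r))

ascending descending : (ℕ → Word) → ℕ → Word
ascending  f n = concatMap f (applyUpTo suc n)
descending f n = concatMap f (map suc (downFrom n))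

ascending-suc : ∀ f n → ascending f (suc n) ≡ ascending f n ++ f (suc n)
ascending-suc f n = begin
  concatMap f (applyUpTo suc (suc n))    ≡⟨ cong (concatMap f) (≡.sym (applyUpTo-∷ʳ suc n)) ⟩
  concatMap f (applyUpTo suc n ∷ʳ suc n) ≡⟨ concatMap-++ f (applyUpTo suc n) (suc n ∷ []) ⟩
  ascending f n ++ f (suc n) ++ []       ≡⟨ cong (ascending f n ++_) (++-identityʳ (f (suc n))) ⟩
  ascending f n ++ f (suc n)             ∎
  where open ≡.≡-Reasoning

module _ (f : ℕ → Word) {i : ℕ}
         (inert : ∀ {k} → Away i k → ∀ p → coordsFrom (suc i) (f k) p ≡ p) where

  private
    act : Word → Coord → Coord
    act = coordsFrom (suc i)

  ascending-below : ∀ {n} → n ≤ i → ∀ p → act (ascending f n) p ≡ p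
  ascending-below {zero}  _      p = refl
  ascending-below {suc n} n+1≤i p = begin
    act (ascending f (suc n)) p
      ≡⟨ cong (λ x → act x p) (ascending-suc f n) ⟩
    act (ascending f n ++ f (suc n)) p
      ≡⟨ coordsFrom-++ (suc i) (ascending f n) _ p ⟩
    act (ascending f n) (act (f (suc n)) p)
      ≡⟨ cong (act (ascending f n)) (inert (inj₁ n+1≤i) p) ⟩
    act (ascending f n) p
      ≡⟨ ascending-below (ℕP.<⇒≤ n+1≤i) p ⟩
    p ∎
    where open ≡.≡-Reasoning

  ascending-own : ∀ p → act (ascending f (suc i)) p ≡ act (f (suc i)) p
  ascending-own p = begin
    act (ascending f (suc i)) p             ≡⟨ cong (λ x → act x p) (ascending-suc f i) ⟩
    act (ascending f i ++ f (suc i)) p      ≡⟨ coordsFrom-++ (suc i) (ascending f i) _ p ⟩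
    act (ascending f i) (act (f (suc i)) p) ≡⟨ ascending-below ℕP.≤-refl _ ⟩
    act (f (suc i)) p                       ∎
    where open ≡.≡-Reasoning

  ascending-above : ∀ {n} → 2 ℕ.+ i ≤ n →
                    ∀ p → act (ascending f n) p ≡ act (f (suc i)) (act (f (2 ℕ.+ i)) p)
  ascending-above {suc n} (s≤s i+1≤n) p with ℕP.m≤n⇒m<n∨m≡n i+1≤n
  ... | inj₂ refl = begin
    act (ascending f (2 ℕ.+ i)) p
      ≡⟨ cong (λ x → act x p) (ascending-suc f (suc i)) ⟩
    act (ascending f (suc i) ++ f (2 ℕ.+ i)) p
      ≡⟨ coordsFrom-++ (suc i) (ascending f (suc i)) _ p ⟩
    act (ascending f (suc i)) (act (f (2 ℕ.+ i)) p)
      ≡⟨ ascending-own _ ⟩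
    act (f (suc i)) (act (f (2 ℕ.+ i)) p) ∎
    where open ≡.≡-Reasoning
  ... | inj₁ i+1<n = begin
    act (ascending f (suc n)) p
      ≡⟨ cong (λ x → act x p) (ascending-suc f n) ⟩
    act (ascending f n ++ f (suc n)) p
      ≡⟨ coordsFrom-++ (suc i) (ascending f n) _ p ⟩
    act (ascending f n) (act (f (suc n)) p)
      ≡⟨ cong (act (ascending f n)) (inert (inj₂ (s≤s i+1<n)) p) ⟩
    act (ascending f n) p
      ≡⟨ ascending-above i+1<n p ⟩
    act (f (suc i)) (act (f (2 ℕ.+ i)) p) ∎
    where open ≡.≡-Reasoning

  descending-below : ∀ {n} → n ≤ i → ∀ p → act (descending f n) p ≡ p
  descending-below {zero}  _      p = refl
  descending-below {suc n} n+1≤i p = begin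
    act (f (suc n) ++ descending f n) p
      ≡⟨ coordsFrom-++ (suc i) (f (suc n)) _ p ⟩
    act (f (suc n)) (act (descending f n) p)
      ≡⟨ cong (act (f (suc n))) (descending-below (ℕP.<⇒≤ n+1≤i) p) ⟩
    act (f (suc n)) p
      ≡⟨ inert (inj₁ n+1≤i) p ⟩
    p ∎
    where open ≡.≡-Reasoning

  descending-own : ∀ p → act (descending f (suc i)) p ≡ act (f (suc i)) p
  descending-own p = begin
    act (f (suc i) ++ descending f i) p
      ≡⟨ coordsFrom-++ (suc i) (f (suc i)) _ p ⟩
    act (f (suc i)) (act (descending f i) p)
      ≡⟨ cong (act (f (suc i))) (descending-below ℕP.≤-refl p) ⟩
    act (f (suc i)) p ∎
    where open ≡.≡-Reasoning

  descending-above : ∀ {n} → 2 ℕ.+ i ≤ n →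
                     ∀ p → act (descending f n) p ≡ act (f (2 ℕ.+ i)) (act (f (suc i)) p)
  descending-above {suc n} (s≤s i+1≤n) p with ℕP.m≤n⇒m<n∨m≡n i+1≤n
  ... | inj₂ refl = begin
    act (f (2 ℕ.+ i) ++ descending f (suc i)) p
      ≡⟨ coordsFrom-++ (suc i) (f (2 ℕ.+ i)) _ p ⟩
    act (f (2 ℕ.+ i)) (act (descending f (suc i)) p)
      ≡⟨ cong (act (f (2 ℕ.+ i))) (descending-own p) ⟩
    act (f (2 ℕ.+ i)) (act (f (suc i)) p) ∎
    where open ≡.≡-Reasoning
  ... | inj₁ i+1<n = begin
    act (f (suc n) ++ descending f n) p
      ≡⟨ coordsFrom-++ (suc i) (f (suc n)) _ p ⟩
    act (f (suc n)) (act (descending f n) p)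
      ≡⟨ inert (inj₂ (s≤s i+1<n)) _ ⟩
    act (descending f n) p
      ≡⟨ descending-above i+1<n p ⟩
    act (f (2 ℕ.+ i)) (act (f (suc i)) p) ∎
    where open ≡.≡-Reasoning

-- With b k = ∣ β m x k ∣ and a k = ∣ α k x ∣, shape n is bracket x m n.
module BracketShape (b a : ℕ → ℕ) (m : ℕ) where

  dᵐ uᵇ dᵃ uᵇdᵃ : ℕ → Word
  dᵐ   k = replicate m (d k)
  uᵇ   k = replicate (b k) (u k)
  dᵃ   k = replicate (a k) (d k)
  uᵇdᵃ k = uᵇ k ++ dᵃ k

  shape : ℕ → Word
  shape n = ascending dᵐ n ++ descending uᵇdᵃ n

  module _ {i : ℕ} where

    private
      act : Word → Coord → Coord
      act = coordsFrom (suc i)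

    dᵐ-inert : ∀ {k} → Away i k → ∀ p → act (dᵐ k) p ≡ p
    dᵐ-inert away = replicate-inert (onIndex-away pushD pushU away) m

    uᵇdᵃ-inert : ∀ {k} → Away i k → ∀ p → act (uᵇdᵃ k) p ≡ p
    uᵇdᵃ-inert {k} away p = ≡.trans (coordsFrom-++ (suc i) (uᵇ k) _ p)
      (≡.trans (replicate-inert (onIndex-away pushU pushD away) (b k) _)
               (replicate-inert (onIndex-away pushD pushU away) (a k) p))

    uᵇdᵃ-own : act (uᵇdᵃ (suc i)) (0 , 0) ≡ (b (suc i) , a (suc i))
    uᵇdᵃ-own = begin
      act (uᵇdᵃ (suc i)) (0 , 0)
        ≡⟨ coordsFrom-++ (suc i) (uᵇ (suc i)) _ _ ⟩
      act (uᵇ (suc i)) (act (dᵃ (suc i)) (0 , 0))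
        ≡⟨ cong (act (uᵇ (suc i))) (replicate-pushD-zero (onIndex-self (suc i) pushD pushU) (a (suc i)) 0) ⟩
      act (uᵇ (suc i)) (0 , a (suc i))
        ≡⟨ replicate-pushU (onIndex-self (suc i) pushU pushD) (b (suc i)) 0 (a (suc i)) ⟩
      (b (suc i) , a (suc i)) ∎
      where open ≡.≡-Reasoning

    uᵇdᵃ-next : ∀ {K c′} → b (suc i) ℕ.+ a (2 ℕ.+ i) ≡ K ℕ.+ b (2 ℕ.+ i) →
                  act (uᵇdᵃ (2 ℕ.+ i)) (b (suc i) , c′) ≡ (K , c′)
    uᵇdᵃ-next {K} {c′} e = begin
      act (uᵇdᵃ (2 ℕ.+ i)) (b (suc i) , c′)
        ≡⟨ coordsFrom-++ (suc i) (uᵇ (2 ℕ.+ i)) _ _ ⟩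
      act (uᵇ (2 ℕ.+ i)) (act (dᵃ (2 ℕ.+ i)) (b (suc i) , c′))
        ≡⟨ cong (act (uᵇ (2 ℕ.+ i))) (replicate-pushU (onIndex-next (suc i) pushD pushU) (a (2 ℕ.+ i)) (b (suc i)) c′) ⟩
      act (uᵇ (2 ℕ.+ i)) (b (suc i) ℕ.+ a (2 ℕ.+ i) , c′)
        ≡⟨ cong (λ t → act (uᵇ (2 ℕ.+ i)) (t , c′)) e ⟩
      act (uᵇ (2 ℕ.+ i)) (K ℕ.+ b (2 ℕ.+ i) , c′)
        ≡⟨ replicate-pushD (onIndex-next (suc i) pushU pushD) (b (2 ℕ.+ i)) K c′ ⟩
      (K , c′) ∎
      where open ≡.≡-Reasoning

    dᵐ-own : ∀ {K c′} → act (dᵐ (suc i)) (K ℕ.+ m , c′) ≡ (K , c′)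
    dᵐ-own {K} {c′} = replicate-pushD (onIndex-self (suc i) pushD pushU) m K c′

    coords-shape-inner : ∀ {n K} → 2 ℕ.+ i ≤ n →
                         b (suc i) ℕ.+ a (2 ℕ.+ i) ≡ K ℕ.+ b (2 ℕ.+ i) →
                         coords (shape n) (suc i) ≡ (K , a (suc i))
    coords-shape-inner {n} {K} i+2≤n e = begin
      act (ascending dᵐ n ++ descending uᵇdᵃ n) (0 , 0)
        ≡⟨ coordsFrom-++ (suc i) (ascending dᵐ n) _ _ ⟩
      act (ascending dᵐ n) (act (descending uᵇdᵃ n) (0 , 0))
        ≡⟨ cong (act (ascending dᵐ n)) (descending-above uᵇdᵃ uᵇdᵃ-inert i+2≤n _) ⟩
      act (ascending dᵐ n) (act (uᵇdᵃ (2 ℕ.+ i)) (act (uᵇdᵃ (suc i)) (0 , 0)))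
        ≡⟨ cong (λ p → act (ascending dᵐ n) (act (uᵇdᵃ (2 ℕ.+ i)) p)) uᵇdᵃ-own ⟩
      act (ascending dᵐ n) (act (uᵇdᵃ (2 ℕ.+ i)) (b (suc i) , a (suc i)))
        ≡⟨ cong (act (ascending dᵐ n)) (uᵇdᵃ-next e) ⟩
      act (ascending dᵐ n) (K , a (suc i))
        ≡⟨ ascending-above dᵐ dᵐ-inert i+2≤n _ ⟩
      act (dᵐ (suc i)) (act (dᵐ (2 ℕ.+ i)) (K , a (suc i)))
        ≡⟨ cong (act (dᵐ (suc i))) (replicate-pushU (onIndex-next (suc i) pushD pushU) m K (a (suc i))) ⟩
      act (dᵐ (suc i)) (K ℕ.+ m , a (suc i))
        ≡⟨ dᵐ-own ⟩
      (K , a (suc i)) ∎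
      where open ≡.≡-Reasoning

    coords-shape-top : ∀ {K} → b (suc i) ≡ K ℕ.+ m →
                       coords (shape (suc i)) (suc i) ≡ (K , a (suc i))
    coords-shape-top {K} e = begin
      act (ascending dᵐ (suc i) ++ descending uᵇdᵃ (suc i)) (0 , 0)
        ≡⟨ coordsFrom-++ (suc i) (ascending dᵐ (suc i)) _ _ ⟩
      act (ascending dᵐ (suc i)) (act (descending uᵇdᵃ (suc i)) (0 , 0))
        ≡⟨ cong (act (ascending dᵐ (suc i))) (descending-own uᵇdᵃ uᵇdᵃ-inert _) ⟩
      act (ascending dᵐ (suc i)) (act (uᵇdᵃ (suc i)) (0 , 0))
        ≡⟨ cong (act (ascending dᵐ (suc i))) uᵇdᵃ-own ⟩
      act (ascending dᵐ (suc i)) (b (suc i) , a (suc i))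
        ≡⟨ ascending-own dᵐ dᵐ-inert _ ⟩
      act (dᵐ (suc i)) (b (suc i) , a (suc i))
        ≡⟨ cong (λ t → act (dᵐ (suc i)) (t , a (suc i))) e ⟩
      act (dᵐ (suc i)) (K ℕ.+ m , a (suc i))
        ≡⟨ dᵐ-own ⟩
      (K , a (suc i)) ∎
      where open ≡.≡-Reasoning

module _ {N : ℕ} (f : ℕ → Word) where

  indicesIn-ascending : ∀ {n} → (∀ {k} → 1 ≤ k → k ≤ n → IndicesIn N (f k)) →
                        IndicesIn N (ascending f n)
  indicesIn-ascending {n} h = concat⁺ (map⁺ (applyUpTo⁺₁ suc n (h (s≤s z≤n))))

  indicesIn-descending : ∀ n → (∀ {k} → 1 ≤ k → k ≤ n → IndicesIn N (f k)) →
                         IndicesIn N (descending f n)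
  indicesIn-descending zero    h = []
  indicesIn-descending (suc n) h =
    ++⁺ (h (s≤s z≤n) ℕP.≤-refl) (indicesIn-descending n (λ k≥1 k≤n → h k≥1 (ℕP.m≤n⇒m≤1+n k≤n)))

indicesIn-bracket : ∀ x m n → IndicesIn n (bracket x m n)
indicesIn-bracket x m n = ++⁺
  (indicesIn-ascending dᵐ (λ k≥1 k≤n → replicate⁺ m (k≥1 , k≤n)))
  (indicesIn-descending uᵇdᵃ n (λ {k} k≥1 k≤n →
    ++⁺ (replicate⁺ ∣ β m x k ∣ (k≥1 , k≤n)) (replicate⁺ ∣ α k x ∣ (k≥1 , k≤n))))
  where open BracketShape (λ k → ∣ β m x k ∣) (λ k → ∣ α k x ∣) m

indicesIn-word : ∀ {n} x → ValidWord x → nW x ≤ n → IndicesIn n x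
indicesIn-word []        []            _   = []
indicesIn-word (u i ∷ x) (i≥1 ∷ valid) x≤n =
  (i≥1 , ℕP.m⊔n≤o⇒m≤o i _ x≤n) ∷ indicesIn-word x valid (ℕP.m⊔n≤o⇒n≤o i _ x≤n)
indicesIn-word (d i ∷ x) (i≥1 ∷ valid) x≤n =
  (i≥1 , ℕP.m⊔n≤o⇒m≤o i _ x≤n) ∷ indicesIn-word x valid (ℕP.m⊔n≤o⇒n≤o i _ x≤n)

α-nonneg : ∀ k x → + 0 ≤ℤ α k x
α-nonneg k []      = ℤP.≤-refl
α-nonneg k (c ∷ x) = ℤP.≤-trans (α-nonneg k x) (ℤP.i≤j⊔i _ (α k x))

private
  up-two : ∀ W L → (1ℤ + W) + (1ℤ + L) ≡ (W + L) + + 2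
  up-two = solve-∀

  down-zero : ∀ W L → (-1ℤ + W) + (1ℤ + L) ≡ (W + L) + + 0
  down-zero = solve-∀

  same-one : ∀ W L → W + (1ℤ + L) ≡ (W + L) + + 1
  same-one = solve-∀

0≤i⇒0≤i+n : ∀ {X Y} n → Y ≡ X + + n → + 0 ≤ℤ X → + 0 ≤ℤ Y
0≤i⇒0≤i+n {X} n refl 0≤X = ℤP.≤-trans 0≤X (ℤP.i≤i+j X (+ n))

w+length-nonneg : ∀ k x → + 0 ≤ℤ w k x + + length x
w+length-nonneg k [] = ℤP.≤-refl
w+length-nonneg k (u j ∷ x) with k ℕ.≟ j
... | yes _ = 0≤i⇒0≤i+n 2 (up-two (w k x) (+ length x)) (w+length-nonneg k x)
... | no _  = 0≤i⇒0≤i+n 1 (same-one (w k x) (+ length x)) (w+length-nonneg k x)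
w+length-nonneg k (d j ∷ x) with k ℕ.≟ j
... | yes _ = 0≤i⇒0≤i+n 0 (down-zero (w k x) (+ length x)) (w+length-nonneg k x)
... | no _  = 0≤i⇒0≤i+n 1 (same-one (w k x) (+ length x)) (w+length-nonneg k x)

β-nonneg : ∀ {m} x k → length x ≤ m → + 0 ≤ℤ β m x k
β-nonneg x k x≤m with ℕP.m≤n⇒∃[o]m+o≡n x≤m
... | e , refl = ℤP.≤-trans (ℤP.+-mono-≤ (α-nonneg k x) (0≤i⇒0≤i+n e refl (w+length-nonneg k x)))
                            (ℤP.≤-reflexive (regroup (α k x) (w k x) (+ length x) (+ e)))
  where
  regroup : ∀ A W L E → A + ((W + L) + E) ≡ (A + W) + (L + E)
  regroup = solve-∀

w-beyond : ∀ k x → nW x < k → w k x ≡ + 0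
w-beyond k []        _      = refl
w-beyond k (u j ∷ x) x<k with k ℕ.≟ j
... | yes refl = ⊥-elim (ℕP.<-irrefl refl (ℕP.≤-<-trans (ℕP.m≤m⊔n k (nW x)) x<k))
... | no _     = w-beyond k x (ℕP.≤-<-trans (ℕP.m≤n⊔m j (nW x)) x<k)
w-beyond k (d j ∷ x) x<k with k ℕ.≟ j
... | yes refl = ⊥-elim (ℕP.<-irrefl refl (ℕP.≤-<-trans (ℕP.m≤m⊔n k (nW x)) x<k))
... | no _     = w-beyond k x (ℕP.≤-<-trans (ℕP.m≤n⊔m j (nW x)) x<k)

private
  inner-balance : ∀ A A′ W W′ M → (A + W + M) + A′ ≡ (A - (W′ - W)) + (A′ + W′ + M)
  inner-balance = solve-∀

  top-balance : ∀ A W M → A + W + M ≡ (A - (+ 0 - W)) + M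
  top-balance = solve-∀

  +-injective₂ : ∀ {p q r s} → + p + + q ≡ + r + + s → p ℕ.+ q ≡ r ℕ.+ s
  +-injective₂ {p} {q} {r} {s} e =
    ℤP.+-injective (≡.trans (ℤP.pos-+ p q) (≡.trans e (≡.sym (ℤP.pos-+ r s))))

module _ {x : Word} {m : ℕ} (x≤m : length x ≤ m) where

  b a : ℕ → ℕ
  b k = ∣ β m x k ∣
  a k = ∣ α k x ∣

  open BracketShape b a m

  +a : ∀ k → + a k ≡ α k x
  +a k = ℤP.0≤i⇒+∣i∣≡i (α-nonneg k x)

  +b : ∀ k → + b k ≡ β m x k
  +b k = ℤP.0≤i⇒+∣i∣≡i (β-nonneg x k x≤m)

  a≡C : ∀ {i C} → + C ≡ α i x → a i ≡ C
  a≡C {i} C≡α = ℤP.+-injective (≡.trans (+a i) (≡.sym C≡α))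

  inner-exponents : ∀ {i K} → + K ≡ α (suc i) x - (w (2 ℕ.+ i) x - w (suc i) x) →
                    b (suc i) ℕ.+ a (2 ℕ.+ i) ≡ K ℕ.+ b (2 ℕ.+ i)
  inner-exponents {i} {K} K≡α-Δ = +-injective₂ {b (suc i)} {a (2 ℕ.+ i)} {K} {b (2 ℕ.+ i)} (begin
    + b (suc i) + + a (2 ℕ.+ i)
      ≡⟨ cong₂ _+_ (+b (suc i)) (+a (2 ℕ.+ i)) ⟩
    β m x (suc i) + α (2 ℕ.+ i) x
      ≡⟨ inner-balance (α (suc i) x) (α (2 ℕ.+ i) x) (w (suc i) x) (w (2 ℕ.+ i) x) (+ m) ⟩
    (α (suc i) x - (w (2 ℕ.+ i) x - w (suc i) x)) + β m x (2 ℕ.+ i)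
                                  ≡⟨ cong₂ _+_ (≡.sym K≡α-Δ) (≡.sym (+b (2 ℕ.+ i))) ⟩
    + K + + b (2 ℕ.+ i)           ∎)
    where open ≡.≡-Reasoning

  top-exponent : ∀ {i K} → nW x ≤ suc i → + K ≡ α (suc i) x - (w (2 ℕ.+ i) x - w (suc i) x) →
                 b (suc i) ≡ K ℕ.+ m
  top-exponent {i} {K} x≤i+1 K≡α-Δ = ℤP.+-injective (begin
    + b (suc i)
      ≡⟨ +b (suc i) ⟩
    β m x (suc i)
      ≡⟨ top-balance (α (suc i) x) (w (suc i) x) (+ m) ⟩
    (α (suc i) x - (+ 0 - w (suc i) x)) + + m
      ≡⟨ cong (λ t → (α (suc i) x - (t - w (suc i) x)) + + m) (≡.sym (w-beyond (2 ℕ.+ i) x (s≤s x≤i+1))) ⟩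
    (α (suc i) x - (w (2 ℕ.+ i) x - w (suc i) x)) + + m
      ≡⟨ cong (_+ + m) (≡.sym K≡α-Δ) ⟩
    + K + + m                                          ∎)
    where open ≡.≡-Reasoning

  coords-bracket : ∀ {n j} → nW x ≤ n → 1 ≤ j → j ≤ n → coords (bracket x m n) j ≡ coords x j
  coords-bracket {n} {suc i} x≤n _ i+1≤n
    with coords x (suc i) | coords-represents (suc i) x | ℕP.m≤n⇒m<n∨m≡n i+1≤n
  ... | K , C | C≡α , K≡α-Δ | inj₁ i+2≤n =
    ≡.trans (coords-shape-inner i+2≤n (inner-exponents K≡α-Δ)) (cong (K ,_) (a≡C C≡α))
  ... | K , C | C≡α , K≡α-Δ | inj₂ refl =
    ≡.trans (coords-shape-top (top-exponent x≤n K≡α-Δ)) (cong (K ,_) (a≡C C≡α))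

i≤+∣i∣ : ∀ i → i ≤ℤ + ∣ i ∣
i≤+∣i∣ (+ n)    = ℤP.≤-refl
i≤+∣i∣ -[1+ n ] = -≤+

≈ᴶ-bracket : ∀ {x m n} → ValidWord x → length x ≤ m → nW x ≤ n → x ≈ᴶ bracket x m n
≈ᴶ-bracket {x} {m} {n} valid x≤m x≤n = begin
  x
    ≈⟨ ≈ᴶ-normalForm n x (indicesIn-word x valid x≤n) ⟩
  normalForm (coords x) n
    ≡⟨ normalForm-cong n (λ j≥1 j≤n → ≡.sym (coords-bracket {x} {m} x≤m x≤n j≥1 j≤n)) ⟩
  normalForm (coords (bracket x m n)) n
    ≈⟨ ≈ᴶ-sym (≈ᴶ-normalForm n (bracket x m n) (indicesIn-bracket x m n)) ⟩
  bracket x m n ∎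
  where open ≈ᴶ-Reasoning

-- Taking M ≥ length x makes every β^m_i(x) non-negative, so that ∣_∣ in `bracket` is harmless.
proposition3p7 : ∀ {c ℓ} (R : CommutativeRing c ℓ) (x : Word) → ValidWord x →
    Σ ℕ (λ M → Σ ℕ (λ N → (mW x ≤ℤ + M) × (nW x ≤ N) ×
      (∀ m n → M ≤ m → N ≤ n →
        FreeAlg.InJ R (FreeAlg._⊖_ R (FreeAlg.mon R x) (FreeAlg.mon R (bracket x m n))))))
proposition3p7 R x valid =
  ∣ mW x ∣ ℕ.+ length x , nW x ,
  ℤP.≤-trans (i≤+∣i∣ (mW x)) (+≤+ᶻ (ℕP.m≤m+n _ _)) , ℕP.≤-refl ,
  λ m n M≤m N≤n → ≈ᴶ⇒InJ R (≈ᴶ-bracket valid (ℕP.≤-trans (ℕP.m≤n+m _ _) M≤m) N≤n)
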